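{- Let $G=(V,E)$ be a finite simple graph. At each step of the Wavefront algorithm (described in the context) applied to $G$, each element of the set $\mathcal{C}$ is a closure pair of $G$.
   Context: For $v\in V$, $N(v)$ is the neighborhood of $v$ and $N[v]=N(v)\cup\{v\}$; $n=|V|$. Zero forcing color change rule: a colored vertex with exactly one uncolored neighbor forces that neighbor to become colored. The closure $\mathrm{cl}(S)$ of $S\subseteq V$ is the set of colored vertices obtained from $S$ by applying the rule until no further vertex can be forced. A closure pair of $G$ is an ordered pair $(S,r)$ such that there exists a set $A\subseteq V$ with $\mathrm{cl}(A)=S$ and $|A|=r$. Wavefront algorithm: initialize $\mathcal{C}\leftarrow\{(\emptyset,0)\}$. For $R=1,2,\dots,n$: for each $(S,r)\in\mathcal{C}$: for each $v\in V$: set $S'\leftarrow \mathrm{cl}(S\cup N[v])$ and $r'\leftarrow r+|\{v\}\setminus S|+\max\{|N(v)\setminus S|-1,0\}$; if $r'\le R$ and there is no pair $(S',i)\in\mathcal{C}$ with $i\le R$, then add $(S',r')$ to $\mathcal{C}$, and if moreover $S'=V$, return $r'$. -}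

module Defs where

open import Data.Bool using (Bool; true; false; _∧_; _∨_; not; T)
open import Data.Nat using (ℕ; zero; suc; _+_; _∸_; _≤_; _<_; _≡ᵇ_)
open import Data.Fin using (Fin)
open import Data.Vec using (Vec; tabulate; lookup; foldr)
open import Data.Fin.Subset using (Subset; _∪_; _─_; ⁅_⁆; ∣_∣; ⊥; ⊤)
open import Data.Product using (_×_; _,_; Σ; ∃)
open import Data.List using (List; []; _∷_; [_]; _++_)
open import Data.List.Membership.Propositional using (_∈_)
open import Data.List.Relation.Unary.Any using (Any)
open import Relation.Binary.PropositionalEquality using (_≡_)
open import Relation.Nullary using (¬_)

record Graph (n : ℕ) : Set where
  field
    adj     : Fin n → Fin n → Bool
    sym     : ∀ u v → adj u v ≡ adj v u
    irrefl  : ∀ v → adj v v ≡ false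
open Graph public

module _ {n : ℕ} (G : Graph n) where

  N : Fin n → Subset n
  N v = tabulate (adj G v)

  N[_] : Fin n → Subset n
  N[ v ] = N v ∪ ⁅ v ⁆

  private
    anyFin : (Fin n → Bool) → Bool
    anyFin f = foldr _ _∨_ false (tabulate f)

  canForce : Subset n → Fin n → Bool
  canForce S u = lookup S u ∧ (∣ N u ─ S ∣ ≡ᵇ 1)

  forceStep : Subset n → Subset n
  forceStep S = tabulate λ w →
    lookup S w ∨ anyFin (λ u → canForce S u ∧ adj G u w ∧ not (lookup S w))

  iterateForce : ℕ → Subset n → Subset n
  iterateForce zero    S = S
  iterateForce (suc k) S = forceStep (iterateForce k S)

  -- closure cl(S): apply the color change rule until nothing more can be
  -- forced; each non-final round colors ≥ 1 new vertex, so n rounds suffice.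
  cl : Subset n → Subset n
  cl S = iterateForce n S

  ClosurePair : Subset n × ℕ → Set
  ClosurePair (S , r) = Σ (Subset n) λ A → (cl A ≡ S) × (∣ A ∣ ≡ r)

  S′ : Subset n → Fin n → Subset n
  S′ S v = cl (S ∪ N[ v ])

  r′ : Subset n → ℕ → Fin n → ℕ
  r′ S r v = r + ∣ ⁅ v ⁆ ─ S ∣ + (∣ N v ─ S ∣ ∸ 1)

  -- Reachable R C : C is a possible content of 𝒞 at some moment of the
  -- Wavefront algorithm, while the outer loop is at round R.
  -- (Covers every order of iteration over 𝒞 and V.)
  data Reachable : ℕ → List (Subset n × ℕ) → Set where
    init  : Reachable 1 [ (⊥ , 0) ]
    round : ∀ {R C} → Reachable R C → R < n → Reachable (suc R) C
    add   : ∀ {R C S r} → Reachable R C → R ≤ n → (S , r) ∈ C → (v : Fin n) →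
            r′ S r v ≤ R →
            ¬ Any (λ p → (Σ ℕ λ i → p ≡ (S′ S v , i) × i ≤ R)) C →
            Reachable R (C ++ [ (S′ S v , r′ S r v) ])

module Submission where

-- The algorithm only ever inserts (cl (S ∪ N[v]) , r′) for a stored pair
-- (S , r), so by induction on the run it suffices to show that this
-- extension step maps closure pairs to closure pairs (the start pair
-- (∅ , 0) is one because ∅ is its own closure).  If cl A = S and |A| = r,
-- take A′ = A ∪ ({v} ∖ S) ∪ E, where E is N(v) ∖ S with one vertex removed.
-- Then A′ ⊆ S ∪ N[v] ⊆ cl A′: S = cl A and v lie in cl A′, and at most one
-- neighbour of v is missing from cl A′, so v forces it.  Hence
-- cl A′ = cl (S ∪ N[v]), and the three parts of A′ are disjoint, giving
-- |A′| = r′.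

open import Defs
open import Data.Bool using (Bool; true; false; _∧_; _∨_; not; T)
open import Data.Bool.Properties using (T-∨; T-∧; T-≡)
open import Data.Nat using (ℕ; zero; suc; _+_; _∸_; _≤_; _<_; z≤n; s≤s)
open import Data.Nat.Properties using (≤-antisym; ≤-trans; ≤-reflexive; +-suc; ≡ᵇ⇒≡; ≡⇒≡ᵇ)
open import Data.Fin using (Fin; zero; suc)
open import Data.Vec using ([]; _∷_; here; there; tabulate; lookup; foldr)
open import Data.Vec.Properties using ([]=⇒lookup; lookup⇒[]=; lookup∘tabulate)
open import Data.Fin.Subset
open import Data.Fin.Subset.Properties
open import Data.Product using (_×_; _,_; ∃)
open import Data.Sum using (_⊎_; inj₁; inj₂; [_,_]′)
open import Data.Empty using (⊥-elim)
open import Data.List using (List)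
open import Data.List.Membership.Propositional using () renaming (_∈_ to _∈ₗ_)
open import Data.List.Membership.Propositional.Properties using (∈-++⁻)
open import Data.List.Relation.Unary.Any as Any using ()
open import Function.Bundles using (_⇔_; mk⇔; Equivalence)
open import Relation.Nullary using (yes; no)
open import Relation.Binary.PropositionalEquality as ≡ using (_≡_; refl; cong; cong₂; trans; subst)

open Equivalence using (to; from)

∈⇔T : ∀ {n} {p : Subset n} {x : Fin n} → x ∈ p ⇔ T (lookup p x)
∈⇔T {p = p} {x} = mk⇔ (λ x∈p → from T-≡ ([]=⇒lookup x∈p)) (λ t → lookup⇒[]= x p (to T-≡ t))

∈-tabulate : ∀ {n} {f : Fin n → Bool} {x : Fin n} → x ∈ tabulate f ⇔ T (f x)
∈-tabulate {f = f} {x} = subst (λ b → x ∈ tabulate f ⇔ T b) (lookup∘tabulate f x) ∈⇔T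

∉⇒T-not : ∀ {n} {p : Subset n} {x : Fin n} → x ∉ p → T (not (lookup p x))
∉⇒T-not {p = p} {x} x∉p with lookup p x in eq
... | true  = ⊥-elim (x∉p (lookup⇒[]= x p eq))
... | false = _

T-anyFin : ∀ {n} (f : Fin n → Bool) →
           T (foldr (λ _ → Bool) _∨_ false (tabulate f)) ⇔ ∃ λ u → T (f u)
T-anyFin {zero}  f = mk⇔ (λ ()) (λ { (() , _) })
T-anyFin {suc n} f = mk⇔ found search
  where
  rest : T (foldr (λ _ → Bool) _∨_ false (tabulate (λ i → f (suc i)))) ⇔ ∃ λ u → T (f (suc u))
  rest = T-anyFin (λ i → f (suc i))

  found : T (f zero ∨ foldr (λ _ → Bool) _∨_ false (tabulate (λ i → f (suc i)))) → ∃ λ u → T (f u)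
  found t with to T-∨ t
  ... | inj₁ t₀ = zero , t₀
  ... | inj₂ ts = let u , tu = to rest ts in suc u , tu

  search : (∃ λ u → T (f u)) → T (f zero ∨ foldr (λ _ → Bool) _∨_ false (tabulate (λ i → f (suc i))))
  search (zero  , t) = from T-∨ (inj₁ t)
  search (suc u , t) = from T-∨ (inj₂ (from rest (u , t)))

x∈p─q⇒x∉q : ∀ {n} {p q : Subset n} {x : Fin n} → x ∈ p ─ q → x ∉ q
x∈p─q⇒x∉q {p = _ ∷ p} {outside ∷ q} (there x∈) (there x∈q) = x∈p─q⇒x∉q {p = p} x∈ x∈q
x∈p─q⇒x∉q {p = _ ∷ p} {inside  ∷ q} (there x∈) (there x∈q) = x∈p─q⇒x∉q {p = p} x∈ x∈q

─-antimonoʳ : ∀ {n} (p : Subset n) {q r : Subset n} → r ⊆ q → p ─ q ⊆ p ─ r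
─-antimonoʳ p r⊆q x∈ = x∈p∧x∉q⇒x∈p─q (p─q⊆p p _ x∈) (λ x∈r → x∈p─q⇒x∉q {p = p} x∈ (r⊆q x∈r))

x∈p⇒1≤∣p∣ : ∀ {n} {p : Subset n} {x : Fin n} → x ∈ p → 1 ≤ ∣ p ∣
x∈p⇒1≤∣p∣ x∈p = ≤-trans (s≤s z≤n) (x∈p⇒∣p-x∣<∣p∣ x∈p)

Disjoint : ∀ {n} → Subset n → Subset n → Set
Disjoint p q = ∀ {x} → x ∈ p → x ∉ q

∣p∪q∣≡∣p∣+∣q∣ : ∀ {n} (p q : Subset n) → Disjoint p q → ∣ p ∪ q ∣ ≡ ∣ p ∣ + ∣ q ∣
∣p∪q∣≡∣p∣+∣q∣ []            []            _ = refl
∣p∪q∣≡∣p∣+∣q∣ (inside ∷ p)  (inside ∷ q)  d = ⊥-elim (d here here)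
∣p∪q∣≡∣p∣+∣q∣ (inside ∷ p)  (outside ∷ q) d = cong suc (∣p∪q∣≡∣p∣+∣q∣ p q (λ x∈p x∈q → d (there x∈p) (there x∈q)))
∣p∪q∣≡∣p∣+∣q∣ (outside ∷ p) (inside ∷ q)  d =
  trans (cong suc (∣p∪q∣≡∣p∣+∣q∣ p q (λ x∈p x∈q → d (there x∈p) (there x∈q)))) (≡.sym (+-suc ∣ p ∣ ∣ q ∣))
∣p∪q∣≡∣p∣+∣q∣ (outside ∷ p) (outside ∷ q) d = ∣p∪q∣≡∣p∣+∣q∣ p q (λ x∈p x∈q → d (there x∈p) (there x∈q))

⊆⇒≡⊎∣<∣ : ∀ {n} {p q : Subset n} → p ⊆ q → p ≡ q ⊎ ∣ p ∣ < ∣ q ∣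
⊆⇒≡⊎∣<∣ {p = []}          {[]}          _   = inj₁ refl
⊆⇒≡⊎∣<∣ {p = inside ∷ p}  {outside ∷ q} p⊆q with () ← p⊆q here
⊆⇒≡⊎∣<∣ {p = outside ∷ p} {inside ∷ q}  p⊆q = inj₂ (s≤s (p⊆q⇒∣p∣≤∣q∣ (drop-∷-⊆ p⊆q)))
⊆⇒≡⊎∣<∣ {p = inside ∷ p}  {inside ∷ q}  p⊆q =
  [ (λ p≡q → inj₁ (cong (inside ∷_) p≡q)) , (λ lt → inj₂ (s≤s lt)) ]′ (⊆⇒≡⊎∣<∣ (drop-∷-⊆ p⊆q))
⊆⇒≡⊎∣<∣ {p = outside ∷ p} {outside ∷ q} p⊆q =
  [ (λ p≡q → inj₁ (cong (outside ∷_) p≡q)) , inj₂ ]′ (⊆⇒≡⊎∣<∣ (drop-∷-⊆ p⊆q))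

∣p─p∣≡0 : ∀ {n} (p : Subset n) → ∣ p ─ p ∣ ≡ 0
∣p─p∣≡0 []            = refl
∣p─p∣≡0 (inside ∷ p)  = ∣p─p∣≡0 p
∣p─p∣≡0 (outside ∷ p) = ∣p─p∣≡0 p

dropOne : ∀ {n} → Subset n → Subset n
dropOne []            = []
dropOne (inside ∷ p)  = outside ∷ p
dropOne (outside ∷ p) = outside ∷ dropOne p

dropOne-⊆ : ∀ {n} (p : Subset n) → dropOne p ⊆ p
dropOne-⊆ (inside ∷ p)  (there x∈) = there x∈
dropOne-⊆ (outside ∷ p) (there x∈) = there (dropOne-⊆ p x∈)

∣dropOne∣ : ∀ {n} (p : Subset n) → ∣ dropOne p ∣ ≡ ∣ p ∣ ∸ 1
∣dropOne∣ []            = refl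
∣dropOne∣ (inside ∷ p)  = refl
∣dropOne∣ (outside ∷ p) = ∣dropOne∣ p

∣p─dropOne∣≤1 : ∀ {n} (p : Subset n) → ∣ p ─ dropOne p ∣ ≤ 1
∣p─dropOne∣≤1 []            = z≤n
∣p─dropOne∣≤1 (inside ∷ p)  = s≤s (≤-reflexive (∣p─p∣≡0 p))
∣p─dropOne∣≤1 (outside ∷ p) = ∣p─dropOne∣≤1 p

module _ {n : ℕ} (G : Graph n) where

  ∈N⇔adj : ∀ {v x : Fin n} → x ∈ N G v ⇔ T (adj G v x)
  ∈N⇔adj = ∈-tabulate

  loopless : ∀ (v : Fin n) → v ∉ N G v
  loopless v v∈Nv with () ← subst T (irrefl G v) (to ∈N⇔adj v∈Nv)

  Forces : Subset n → Fin n → Fin n → Set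
  Forces S u w = u ∈ S × ∣ N G u ─ S ∣ ≡ 1 × w ∈ N G u

  forceStep-extensive : ∀ (S : Subset n) → S ⊆ forceStep G S
  forceStep-extensive S w∈S = from ∈-tabulate (from T-∨ (inj₁ (to ∈⇔T w∈S)))

  forceStep⁺ : ∀ {S : Subset n} {u w : Fin n} → Forces S u w → w ∈ forceStep G S
  forceStep⁺ {S} {u} {w} (u∈S , one , w∈Nu) with w ∈? S
  ... | yes w∈S = forceStep-extensive S w∈S
  ... | no  w∉S = from ∈-tabulate (from T-∨ (inj₂ (from (T-anyFin _) (u , forcing))))
    where
    forcing : T (canForce G S u ∧ adj G u w ∧ not (lookup S w))
    forcing = from T-∧ (from T-∧ (to ∈⇔T u∈S , ≡⇒≡ᵇ _ 1 one) ,
                        from T-∧ (to ∈N⇔adj w∈Nu , ∉⇒T-not w∉S))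

  forceStep⁻ : ∀ {S : Subset n} {w : Fin n} → w ∈ forceStep G S → w ∈ S ⊎ ∃ λ u → Forces S u w
  forceStep⁻ w∈ with to T-∨ (to ∈-tabulate w∈)
  ... | inj₁ t = inj₁ (from ∈⇔T t)
  ... | inj₂ t =
    let u , forcing         = to (T-anyFin _) t
        canForce-u , rest   = to T-∧ forcing
        u∈S , one           = to T-∧ canForce-u
        adj-uw , _          = to T-∧ rest
    in inj₂ (u , from ∈⇔T u∈S , ≡ᵇ⇒≡ _ 1 one , from ∈N⇔adj adj-uw)

  Closed : Subset n → Set
  Closed S = forceStep G S ⊆ S

  -- In a closed set, a colored vertex with at most one uncolored neighbour
  -- has all its neighbours colored (otherwise it would force the last one).
  closed-absorbs : ∀ {S : Subset n} {u : Fin n} → Closed S → u ∈ S → ∣ N G u ─ S ∣ ≤ 1 → N G u ⊆ S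
  closed-absorbs {S} closed u∈S ≤1 {x} x∈Nu with x ∈? S
  ... | yes x∈S = x∈S
  ... | no  x∉S = closed (forceStep⁺ (u∈S , ≤-antisym ≤1 (x∈p⇒1≤∣p∣ (x∈p∧x∉q⇒x∈p─q x∈Nu x∉S)) , x∈Nu))

  forceStep-least : ∀ {S T′ : Subset n} → S ⊆ T′ → Closed T′ → forceStep G S ⊆ T′
  forceStep-least S⊆T′ closed w∈ with forceStep⁻ w∈
  ... | inj₁ w∈S = S⊆T′ w∈S
  ... | inj₂ (u , u∈S , one , w∈Nu) =
    closed-absorbs closed (S⊆T′ u∈S) (≤-trans (p⊆q⇒∣p∣≤∣q∣ (─-antimonoʳ (N G u) S⊆T′)) (≤-reflexive one)) w∈Nu

  closed-fixed : ∀ {S : Subset n} → Closed S → forceStep G S ≡ S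
  closed-fixed {S} closed = ⊆-antisym closed (forceStep-extensive S)

  forceStep-closed : ∀ (S : Subset n) → Closed S → Closed (forceStep G S)
  forceStep-closed S closed = subst Closed (≡.sym (closed-fixed closed)) (λ {x} → closed)

  forceStep-progress : ∀ (S : Subset n) → Closed S ⊎ ∣ S ∣ < ∣ forceStep G S ∣
  forceStep-progress S = [ (λ S≡F → inj₁ (λ {x} → ⊆-reflexive (≡.sym S≡F))) , inj₂ ]′
                           (⊆⇒≡⊎∣<∣ (forceStep-extensive S))

  iterate-extensive : ∀ k (S : Subset n) → S ⊆ iterateForce G k S
  iterate-extensive zero    S x∈ = x∈
  iterate-extensive (suc k) S x∈ = forceStep-extensive _ (iterate-extensive k S x∈)

  iterate-least : ∀ k {S T′ : Subset n} → S ⊆ T′ → Closed T′ → iterateForce G k S ⊆ T′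
  iterate-least zero    S⊆T′ closed = S⊆T′
  iterate-least (suc k) S⊆T′ closed = forceStep-least (iterate-least k S⊆T′ closed) closed

  iterate-grows : ∀ k (S : Subset n) → k ≤ ∣ iterateForce G k S ∣ ⊎ Closed (iterateForce G k S)
  iterate-grows zero    S = inj₁ z≤n
  iterate-grows (suc k) S with iterate-grows k S
  ... | inj₂ closed = inj₂ (forceStep-closed _ closed)
  ... | inj₁ k≤ with forceStep-progress (iterateForce G k S)
  ...   | inj₁ closed = inj₂ (forceStep-closed _ closed)
  ...   | inj₂ grew   = inj₁ (≤-trans (s≤s k≤) grew)

  cl-extensive : ∀ (S : Subset n) → S ⊆ cl G S
  cl-extensive = iterate-extensive n

  cl-least : ∀ {S T′ : Subset n} → S ⊆ T′ → Closed T′ → cl G S ⊆ T′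
  cl-least = iterate-least n

  -- n rounds suffice: either a closed set was reached or every vertex is colored.
  cl-closed : ∀ (S : Subset n) → Closed (cl G S)
  cl-closed S with iterate-grows n S
  ... | inj₂ closed = closed
  ... | inj₁ n≤ = subst Closed (≡.sym (∣p∣≡n⇒p≡⊤ (≤-antisym (∣p∣≤n (cl G S)) n≤))) (λ {x} _ → ∈⊤)

  cl-mono : ∀ {S T′ : Subset n} → S ⊆ T′ → cl G S ⊆ cl G T′
  cl-mono {T′ = T′} S⊆T′ = cl-least (λ x∈ → cl-extensive T′ (S⊆T′ x∈)) (cl-closed T′)

  cl-squeeze : ∀ {X Y : Subset n} → X ⊆ Y → Y ⊆ cl G X → cl G X ≡ cl G Y
  cl-squeeze {X} {Y} X⊆Y Y⊆clX = ⊆-antisym (cl-mono X⊆Y) (cl-least Y⊆clX (cl-closed X))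

  ⊥-closed : Closed ⊥
  ⊥-closed w∈ = [ (λ w∈⊥ → w∈⊥) , (λ { (_ , u∈⊥ , _) → ⊥-elim (∉⊥ u∈⊥) }) ]′ (forceStep⁻ w∈)

  closurePair-∅ : ClosurePair G (⊥ , 0)
  closurePair-∅ = ⊥ , ⊆-antisym (cl-least ⊆-refl ⊥-closed) (⊆-min (cl G ⊥)) , ∣⊥∣≡0 n

  closurePair-step : ∀ {S : Subset n} {r : ℕ} (v : Fin n) →
                     ClosurePair G (S , r) → ClosurePair G (S′ G S v , r′ G S r v)
  closurePair-step {S} {r} v (A , clA≡S , ∣A∣≡r) = A′ , cl-squeeze A′⊆U U⊆clA′ , ∣A′∣≡r′
    where
    -- the uncolored neighbours D of v, all but one of which are put into A′
    D E B A′ U : Subset n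
    D  = N G v ─ S
    E  = dropOne D
    B  = A ∪ (⁅ v ⁆ ─ S)
    A′ = B ∪ E
    U  = S ∪ N[_] G v

    A⊆S : A ⊆ S
    A⊆S x∈A = subst (_ ∈_) clA≡S (cl-extensive A x∈A)

    E⊆D : E ⊆ D
    E⊆D = dropOne-⊆ D

    A′⊆U : A′ ⊆ U
    A′⊆U x∈A′ with x∈p∪q⁻ B E x∈A′
    ... | inj₂ x∈E = x∈p∪q⁺ (inj₂ (x∈p∪q⁺ (inj₁ (p─q⊆p _ S (E⊆D x∈E)))))
    ... | inj₁ x∈B with x∈p∪q⁻ A _ x∈B
    ...   | inj₁ x∈A = x∈p∪q⁺ (inj₁ (A⊆S x∈A))
    ...   | inj₂ x∈v = x∈p∪q⁺ (inj₂ (x∈p∪q⁺ (inj₂ (p─q⊆p _ S x∈v))))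

    A′⊆clA′ : A′ ⊆ cl G A′
    A′⊆clA′ = cl-extensive A′

    S⊆clA′ : S ⊆ cl G A′
    S⊆clA′ x∈S = cl-mono (λ x∈A → x∈p∪q⁺ (inj₁ (x∈p∪q⁺ (inj₁ x∈A)))) (subst (_ ∈_) (≡.sym clA≡S) x∈S)

    v∈clA′ : v ∈ cl G A′
    v∈clA′ with v ∈? S
    ... | yes v∈S = S⊆clA′ v∈S
    ... | no  v∉S = A′⊆clA′ (x∈p∪q⁺ (inj₁ (x∈p∪q⁺ {p = A} (inj₂ (x∈p∧x∉q⇒x∈p─q (x∈⁅x⁆ v) v∉S)))))

    -- Only the neighbour of v dropped from E can be missing from cl A′.
    few-missing : ∣ N G v ─ cl G A′ ∣ ≤ 1
    few-missing = ≤-trans (p⊆q⇒∣p∣≤∣q∣ missing⊆D─E) (∣p─dropOne∣≤1 D)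
      where
      S∪E⊆clA′ : S ∪ E ⊆ cl G A′
      S∪E⊆clA′ x∈ = [ S⊆clA′ , (λ x∈E → A′⊆clA′ (x∈p∪q⁺ (inj₂ x∈E))) ]′ (x∈p∪q⁻ S E x∈)
      missing⊆D─E : N G v ─ cl G A′ ⊆ D ─ E
      missing⊆D─E = subst (N G v ─ cl G A′ ⊆_) (≡.sym (p─q─r≡p─q∪r (N G v) S E))
                          (─-antimonoʳ (N G v) S∪E⊆clA′)

    -- v forces its last uncolored neighbour, so all of N[v] is in cl A′.
    U⊆clA′ : U ⊆ cl G A′
    U⊆clA′ x∈U with x∈p∪q⁻ S _ x∈U
    ... | inj₁ x∈S    = S⊆clA′ x∈S
    ... | inj₂ x∈N[v] with x∈p∪q⁻ (N G v) _ x∈N[v]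
    ...   | inj₁ x∈Nv = closed-absorbs (cl-closed A′) v∈clA′ few-missing x∈Nv
    ...   | inj₂ x∈v  = subst (_∈ cl G A′) (≡.sym (x∈⁅y⁆⇒x≡y v x∈v)) v∈clA′

    A#v : Disjoint A (⁅ v ⁆ ─ S)
    A#v x∈A x∈v = x∈p─q⇒x∉q {p = ⁅ v ⁆} x∈v (A⊆S x∈A)

    B#E : Disjoint B E
    B#E {x} x∈B x∈E with x∈p∪q⁻ A _ x∈B
    ... | inj₁ x∈A = x∈p─q⇒x∉q {p = N G v} (E⊆D x∈E) (A⊆S x∈A)
    ... | inj₂ x∈v = loopless v (subst (_∈ N G v) (x∈⁅y⁆⇒x≡y v (p─q⊆p _ S x∈v)) (p─q⊆p _ S (E⊆D x∈E)))

    ∣A′∣≡r′ : ∣ A′ ∣ ≡ r′ G S r v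
    ∣A′∣≡r′ = trans (∣p∪q∣≡∣p∣+∣q∣ B E B#E)
                    (cong₂ _+_ (trans (∣p∪q∣≡∣p∣+∣q∣ A _ A#v) (cong (_+ ∣ ⁅ v ⁆ ─ S ∣) ∣A∣≡r)) (∣dropOne∣ D))

lemma2 : ∀ {n : ℕ} (G : Graph n) {R : ℕ} {C : List (Subset n × ℕ)} →
         Reachable G R C → ∀ {p} → p ∈ₗ C → ClosurePair G p
lemma2 G init                           (Any.here refl) = closurePair-∅ G
lemma2 G (round reach _)                p∈C             = lemma2 G reach p∈C
lemma2 G (add {C = C} reach _ q∈C v _ _) p∈C′ with ∈-++⁻ C p∈C′
... | inj₁ p∈C             = lemma2 G reach p∈C
... | inj₂ (Any.here refl) = closurePair-step G v (lemma2 G reach q∈C)
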